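{- Suppose that $(G,\mathcal{H})$ is a cancellative pair on a set $V$, and $V=S\cup T$ is a partition of $V$. If $G[S]$ is a complete graph, then \[ |\mathcal{H}|\le|\mathcal{H}[T]|+|G[T]|+\tfrac12|G[S,T]|+\tfrac13|G[S]| . \]
   Context: For a graph $G$ and a $3$-graph $\mathcal{H}$ on the same vertex set $V$, the pair $(G,\mathcal{H})$ is cancellative if $\partial\mathcal{H}\subseteq G$ (where $\partial\mathcal{H}=\{A:|A|=2,\ A\subset B\text{ for some } B\in\mathcal{H}\}$) and there are no three distinct sets $A,B\in\mathcal{H}$ and $C\in G\cup\mathcal{H}$ with $A\triangle B\subseteq C$. $\mathcal{H}[T]$, $G[T]$, $G[S]$ denote the induced sub(hyper)graphs (edges contained in the given set), and $G[S,T]$ denotes the set of edges of $G$ with one endpoint in $S$ and one in $T$. -}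

module Defs where

open import Data.Nat using (ℕ; zero; suc)
open import Data.Bool using (Bool; true; false; _∧_)
open import Data.List using (List; []; _∷_; _++_; map; length; filter)
open import Data.Vec using (_∷_; [])
open import Data.Fin.Subset using (Subset; inside; outside; _⊆_; _∩_; _∪_; _─_; ∣_∣; Nonempty)
open import Data.Fin.Subset.Properties using (_⊆?_; nonempty?)
open import Data.Empty using (⊥)
open import Data.Sum using (_⊎_)
open import Data.Product using (_×_)
open import Relation.Nullary using (¬_)
open import Relation.Nullary.Decidable using (⌊_⌋)
open import Relation.Binary.PropositionalEquality using (_≡_)
import Data.Bool.Properties as BoolP

-- A (simple) graph on vertex set Fin n: a decidable family of subsets of Fin n,
-- each of which has exactly two elements.  A 3-graph: same with three elements.
Family : ℕ → Set
Family n = Subset n → Bool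

_∈F_ : ∀ {n} → Subset n → Family n → Set
A ∈F F = F A ≡ true

IsGraph : ∀ {n} → Family n → Set
IsGraph {n} G = ∀ (A : Subset n) → A ∈F G → ∣ A ∣ ≡ 2

Is3Graph : ∀ {n} → Family n → Set
Is3Graph {n} H = ∀ (A : Subset n) → A ∈F H → ∣ A ∣ ≡ 3

allSubsets : (n : ℕ) → List (Subset n)
allSubsets zero = [] ∷ []
allSubsets (suc n) = map (outside ∷_) (allSubsets n) ++ map (inside ∷_) (allSubsets n)

card : ∀ {n} → Family n → ℕ
card {n} F = length (filter (λ A → F A BoolP.≟ true) (allSubsets n))

induced : ∀ {n} → Family n → Subset n → Family n
induced F X A = F A ∧ ⌊ A ⊆? X ⌋

-- G[S,T]: edges of G meeting both S and T (for disjoint S,T and 2-sets: one endpoint in each)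
between : ∀ {n} → Family n → Subset n → Subset n → Family n
between G S T A = G A ∧ (⌊ nonempty? (A ∩ S) ⌋ ∧ ⌊ nonempty? (A ∩ T) ⌋)

ShadowIn : ∀ {n} → Family n → Family n → Set
ShadowIn {n} H G = ∀ (B A : Subset n) → B ∈F H → A ⊆ B → ∣ A ∣ ≡ 2 → A ∈F G

_△_ : ∀ {n} → Subset n → Subset n → Subset n
A △ B = (A ─ B) ∪ (B ─ A)

Cancellative : ∀ {n} → Family n → Family n → Set
Cancellative {n} G H =
  ShadowIn H G × (∀ (A B C : Subset n) → A ∈F H → B ∈F H → (C ∈F G ⊎ C ∈F H) →
     ¬ A ≡ B → ¬ A ≡ C → ¬ B ≡ C → A △ B ⊆ C → ⊥)

CompleteOn : ∀ {n} → Family n → Subset n → Set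
CompleteOn {n} G X = ∀ (A : Subset n) → A ⊆ X → ∣ A ∣ ≡ 2 → A ∈F G

-- Classify the triples of H by how many points they have in S and in T.  Those inside T are
-- counted by H[T].  A triple with a + 1 points in S and b in T (a + b = 2) contains a + 1
-- pairs with a points in S and b in T; they are edges since ∂H ⊆ G.  Such a pair lies in at
-- most one triple of that kind: two of them agree on T, so their symmetric difference is a
-- pair inside S, an edge because G[S] is complete, and cancellativity forbids that.  Double
-- counting gives (a + 1) · #triples ≤ #edges for each kind, i.e. the triples with one, two,
-- three points in S number at most |G[T]|, |G[S,T]|/2 and |G[S]|/3.
module Submission where

open import Defs
open import Algebra.Properties.CommutativeSemigroup using (interchange)
open import Data.Bool using (Bool; true; false; _∧_; _∨_)
import Data.Bool.Properties as Bool
open import Data.Fin.Subset using (Subset; inside; outside; _⊆_; _∩_; _∪_; ∁; ⊥; ⊤; ∣_∣; Nonempty)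
open import Data.Fin.Subset.Properties
  using (_⊆?_; nonempty?; anySubset?; drop-∷-⊆; out⊆; in⊆in; p⊆q⇒∣p∣≤∣q∣; ⊆-refl; ⊆-trans;
         p∩q⊆p; p∩q⊆q; x∈p∩q⁺; x∈p∩q⁻; ∣p∩q∣≤∣p∣; Empty-unique; ∣⊥∣≡0)
open import Data.List using ([]; _∷_; _++_; map; filter; length)
open import Data.Nat.ListAction using (sum)
open import Data.Nat.ListAction.Properties using (sum-++)
open import Data.List.Properties using (map-++; map-∘)
open import Data.Nat using (ℕ; zero; suc; s≤s⁻¹; _+_; _*_; _∸_; _≤_; _≟_; z≤n; s≤s; z<s)
open import Data.Nat.Properties
open import Data.Nat.Combinatorics using (nCn≡1; nC1≡n; k>n⇒nCk≡0; nCk≡nC[n∸k]; nCk+nC[k+1]≡[n+1]C[k+1])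
  renaming (_C_ to _choose_)
open import Data.Nat.Tactic.RingSolver using (solve-∀)
open import Data.Product using (_×_; _,_; proj₁; proj₂)
open import Data.Sum using (_⊎_; inj₁; inj₂)
open import Data.Vec using ([]; _∷_; here)
open import Data.Vec.Properties using (∷-injectiveʳ; ≡-dec)
open import Function using (_∘_)
open import Relation.Binary.PropositionalEquality
open import Relation.Nullary using (Dec; does; proof; yes; no; ¬_; contradiction)
open import Relation.Nullary.Decidable using (⌊_⌋; _×-dec_; dec-true; decidable-stable)
open import Relation.Nullary.Reflects using (Reflects; invert)
open import Relation.Unary using (Decidable)

private
  variable
    n : ℕ
    A B B′ C : Subset n
    f g : Subset n → ℕ

⟦_⟧ : Bool → ℕ
⟦ true ⟧  = 1
⟦ false ⟧ = 0

⟦⟧-mono : ∀ {b c} → (b ≡ true → c ≡ true) → ⟦ b ⟧ ≤ ⟦ c ⟧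
⟦⟧-mono {false} _   = z≤n
⟦⟧-mono {true}  b⇒c rewrite b⇒c refl = ≤-refl

⟦⟧≡0 : ∀ {b} → ¬ b ≡ true → ⟦ b ⟧ ≡ 0
⟦⟧≡0 {false} _   = refl
⟦⟧≡0 {true}  b≢t = contradiction refl b≢t

⟦∨⟧≤⟦⟧+⟦⟧ : ∀ b c → ⟦ b ∨ c ⟧ ≤ ⟦ b ⟧ + ⟦ c ⟧
⟦∨⟧≤⟦⟧+⟦⟧ true  _ = s≤s z≤n
⟦∨⟧≤⟦⟧+⟦⟧ false _ = ≤-refl

∧-true⁻ : ∀ {b c} → b ∧ c ≡ true → b ≡ true × c ≡ true
∧-true⁻ {true} c≡t = refl , c≡t

does⇒ : ∀ {X : Set} (x? : Dec X) → does x? ≡ true → X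
does⇒ x? does≡t = invert (subst (Reflects _) does≡t (proof x?))

⌊⌋-true : ∀ {X : Set} (x? : Dec X) → X → ⌊ x? ⌋ ≡ true
⌊⌋-true (yes _) _  = refl
⌊⌋-true (no ¬x) x = contradiction x ¬x

∑ : (Subset n → ℕ) → ℕ
∑ {zero}  f = f []
∑ {suc n} f = ∑ (f ∘ (outside ∷_)) + ∑ (f ∘ (inside ∷_))

∑-zero : (∀ A → f A ≡ 0) → ∑ f ≡ 0
∑-zero {zero}  f≡0 = f≡0 []
∑-zero {suc n} f≡0 = cong₂ _+_ (∑-zero (λ A → f≡0 (outside ∷ A))) (∑-zero (λ A → f≡0 (inside ∷ A)))

∑-mono-≤ : (∀ A → f A ≤ g A) → ∑ f ≤ ∑ g
∑-mono-≤ {zero}  f≤g = f≤g []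
∑-mono-≤ {suc n} f≤g = +-mono-≤ (∑-mono-≤ (λ A → f≤g (outside ∷ A))) (∑-mono-≤ (λ A → f≤g (inside ∷ A)))

∑-distrib-+ : ∀ (f g : Subset n → ℕ) → ∑ (λ A → f A + g A) ≡ ∑ f + ∑ g
∑-distrib-+ {zero}  f g = refl
∑-distrib-+ {suc n} f g = begin
  ∑ (λ A → f₀ A + g₀ A) + ∑ (λ A → f₁ A + g₁ A)
    ≡⟨ cong₂ _+_ (∑-distrib-+ f₀ g₀) (∑-distrib-+ f₁ g₁) ⟩
  (∑ f₀ + ∑ g₀) + (∑ f₁ + ∑ g₁)
    ≡⟨ interchange +-commutativeSemigroup (∑ f₀) (∑ g₀) (∑ f₁) (∑ g₁) ⟩
  (∑ f₀ + ∑ f₁) + (∑ g₀ + ∑ g₁)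
    ∎
  where
  open ≡-Reasoning
  f₀ f₁ g₀ g₁ : Subset n → ℕ
  f₀ = f ∘ (outside ∷_)
  f₁ = f ∘ (inside ∷_)
  g₀ = g ∘ (outside ∷_)
  g₁ = g ∘ (inside ∷_)

*-distribˡ-∑ : ∀ k (f : Subset n → ℕ) → k * ∑ f ≡ ∑ (λ A → k * f A)
*-distribˡ-∑ {zero}  k f = refl
*-distribˡ-∑ {suc n} k f =
  trans (*-distribˡ-+ k (∑ (f ∘ (outside ∷_))) _)
        (cong₂ _+_ (*-distribˡ-∑ k (f ∘ (outside ∷_))) (*-distribˡ-∑ k (f ∘ (inside ∷_))))

∑-single : ∀ A₀ → (∀ A → A ≢ A₀ → f A ≡ 0) → ∑ f ≡ f A₀
∑-single {zero}  []              _     = refl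
∑-single {suc n} (outside ∷ A₀) f≡0 =
  trans (cong₂ _+_ (∑-single A₀ (λ A A≢A₀ → f≡0 (outside ∷ A) (A≢A₀ ∘ ∷-injectiveʳ)))
                   (∑-zero (λ A → f≡0 (inside ∷ A) λ ())))
        (+-identityʳ _)
∑-single {suc n} (inside ∷ A₀) f≡0 =
  cong₂ _+_ (∑-zero (λ A → f≡0 (outside ∷ A) λ ()))
            (∑-single A₀ (λ A A≢A₀ → f≡0 (inside ∷ A) (A≢A₀ ∘ ∷-injectiveʳ)))

∑-comm : ∀ {m} (f : Subset m → Subset n → ℕ) →
         ∑ (λ A → ∑ (λ B → f A B)) ≡ ∑ (λ B → ∑ (λ A → f A B))
∑-comm {m = zero}  f = refl
∑-comm {m = suc m} f =
  trans (cong₂ _+_ (∑-comm (λ A → f (outside ∷ A))) (∑-comm (λ A → f (inside ∷ A))))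
        (sym (∑-distrib-+ (λ B → ∑ (λ A → f (outside ∷ A) B)) _))

∑-⟦⟧≤1 : ∀ (p : Subset n → Bool) → (∀ A A′ → p A ≡ true → p A′ ≡ true → A ≡ A′) →
         ∑ (λ A → ⟦ p A ⟧) ≤ 1
∑-⟦⟧≤1 p unique with anySubset? (λ A → p A Bool.≟ true)
... | yes (A₀ , pA₀) = begin
  ∑ (λ A → ⟦ p A ⟧) ≡⟨ ∑-single A₀ (λ A A≢A₀ → ⟦⟧≡0 (λ pA → A≢A₀ (unique A A₀ pA pA₀))) ⟩
  ⟦ p A₀ ⟧          ≡⟨ cong ⟦_⟧ pA₀ ⟩
  1                 ∎
  where open ≤-Reasoning
... | no none = ≤-trans (≤-reflexive (∑-zero (λ A → ⟦⟧≡0 (λ pA → none (A , pA))))) z≤n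

card≡∑ : ∀ (F : Family n) → card F ≡ ∑ (λ A → ⟦ F A ⟧)
card≡∑ {n} F = trans (length-filter≡sum (allSubsets n)) (sum-map-allSubsets (λ A → ⟦ F A ⟧))
  where
  length-filter≡sum : ∀ L → length (filter (λ A → F A Bool.≟ true) L) ≡ sum (map (λ A → ⟦ F A ⟧) L)
  length-filter≡sum []      = refl
  length-filter≡sum (A ∷ L) with F A
  ... | true  = cong suc (length-filter≡sum L)
  ... | false = length-filter≡sum L

  sum-map-allSubsets : ∀ {m} (f : Subset m → ℕ) → sum (map f (allSubsets m)) ≡ ∑ f
  sum-map-allSubsets {zero}  f = +-identityʳ _
  sum-map-allSubsets {suc m} f = begin
    sum (map f (map (outside ∷_) L ++ map (inside ∷_) L))
      ≡⟨ cong sum (map-++ f (map (outside ∷_) L) _) ⟩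
    sum (map f (map (outside ∷_) L) ++ map f (map (inside ∷_) L))
      ≡⟨ sum-++ (map f (map (outside ∷_) L)) _ ⟩
    sum (map f (map (outside ∷_) L)) + sum (map f (map (inside ∷_) L))
      ≡⟨ cong₂ _+_ (cong sum (map-∘ L)) (cong sum (map-∘ L)) ⟨
    sum (map (f ∘ (outside ∷_)) L) + sum (map (f ∘ (inside ∷_)) L)
      ≡⟨ cong₂ _+_ (sum-map-allSubsets (f ∘ (outside ∷_))) (sum-map-allSubsets (f ∘ (inside ∷_))) ⟩
    ∑ f ∎
    where
    open ≡-Reasoning
    L = allSubsets m

∣p∣≡∣p∩q∣+∣p∩∁q∣ : ∀ (p q : Subset n) → ∣ p ∣ ≡ ∣ p ∩ q ∣ + ∣ p ∩ ∁ q ∣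
∣p∣≡∣p∩q∣+∣p∩∁q∣ []            []            = refl
∣p∣≡∣p∩q∣+∣p∩∁q∣ (outside ∷ p) (_ ∷ q)       = ∣p∣≡∣p∩q∣+∣p∩∁q∣ p q
∣p∣≡∣p∩q∣+∣p∩∁q∣ (inside ∷ p)  (inside ∷ q)  = cong suc (∣p∣≡∣p∩q∣+∣p∩∁q∣ p q)
∣p∣≡∣p∩q∣+∣p∩∁q∣ (inside ∷ p)  (outside ∷ q) =
  trans (cong suc (∣p∣≡∣p∩q∣+∣p∩∁q∣ p q)) (sym (+-suc ∣ p ∩ q ∣ _))

∣p△q∣+2∣p∩q∣≡∣p∣+∣q∣ : ∀ (p q : Subset n) → ∣ p △ q ∣ + 2 * ∣ p ∩ q ∣ ≡ ∣ p ∣ + ∣ q ∣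
∣p△q∣+2∣p∩q∣≡∣p∣+∣q∣ []            []            = refl
∣p△q∣+2∣p∩q∣≡∣p∣+∣q∣ (outside ∷ p) (outside ∷ q) = ∣p△q∣+2∣p∩q∣≡∣p∣+∣q∣ p q
∣p△q∣+2∣p∩q∣≡∣p∣+∣q∣ (inside ∷ p)  (outside ∷ q) = cong suc (∣p△q∣+2∣p∩q∣≡∣p∣+∣q∣ p q)
∣p△q∣+2∣p∩q∣≡∣p∣+∣q∣ (outside ∷ p) (inside ∷ q)  =
  trans (cong suc (∣p△q∣+2∣p∩q∣≡∣p∣+∣q∣ p q)) (sym (+-suc ∣ p ∣ _))
∣p△q∣+2∣p∩q∣≡∣p∣+∣q∣ (inside ∷ p)  (inside ∷ q)  = begin
  ∣ p △ q ∣ + 2 * suc ∣ p ∩ q ∣     ≡⟨ shift ∣ p △ q ∣ ∣ p ∩ q ∣ ⟩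
  2 + (∣ p △ q ∣ + 2 * ∣ p ∩ q ∣)   ≡⟨ cong (2 +_) (∣p△q∣+2∣p∩q∣≡∣p∣+∣q∣ p q) ⟩
  2 + (∣ p ∣ + ∣ q ∣)               ≡⟨ cong suc (+-suc ∣ p ∣ ∣ q ∣) ⟨
  suc ∣ p ∣ + suc ∣ q ∣             ∎
  where
  open ≡-Reasoning
  shift : ∀ d i → d + 2 * suc i ≡ 2 + (d + 2 * i)
  shift = solve-∀

p⊆q∧∣q∣≤∣p∣⇒p≡q : ∀ {p q : Subset n} → p ⊆ q → ∣ q ∣ ≤ ∣ p ∣ → p ≡ q
p⊆q∧∣q∣≤∣p∣⇒p≡q {p = []}          {[]}          _   _ = refl
p⊆q∧∣q∣≤∣p∣⇒p≡q {p = outside ∷ p} {outside ∷ q} p⊆q ∣q∣≤∣p∣ =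
  cong (outside ∷_) (p⊆q∧∣q∣≤∣p∣⇒p≡q (drop-∷-⊆ p⊆q) ∣q∣≤∣p∣)
p⊆q∧∣q∣≤∣p∣⇒p≡q {p = inside ∷ p}  {inside ∷ q}  p⊆q (s≤s ∣q∣≤∣p∣) =
  cong (inside ∷_) (p⊆q∧∣q∣≤∣p∣⇒p≡q (drop-∷-⊆ p⊆q) ∣q∣≤∣p∣)
p⊆q∧∣q∣≤∣p∣⇒p≡q {p = outside ∷ p} {inside ∷ q}  p⊆q ∣q∣<∣p∣ =
  contradiction (p⊆q⇒∣p∣≤∣q∣ (drop-∷-⊆ p⊆q)) (<⇒≱ ∣q∣<∣p∣)
p⊆q∧∣q∣≤∣p∣⇒p≡q {p = inside ∷ p}  {outside ∷ q} p⊆q _ = contradiction (p⊆q here) λ ()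

∣p∩q∣≡∣p∣⇒p⊆q : ∀ (p q : Subset n) → ∣ p ∩ q ∣ ≡ ∣ p ∣ → p ⊆ q
∣p∩q∣≡∣p∣⇒p⊆q p q ∣p∩q∣≡∣p∣ =
  subst (_⊆ q) (p⊆q∧∣q∣≤∣p∣⇒p≡q (p∩q⊆p p q) (≤-reflexive (sym ∣p∩q∣≡∣p∣))) (p∩q⊆q p q)

∣p∩q∣≡0⇒p⊆∁q : ∀ (p q : Subset n) → ∣ p ∩ q ∣ ≡ 0 → p ⊆ ∁ q
∣p∩q∣≡0⇒p⊆∁q p q ∣p∩q∣≡0 =
  ∣p∩q∣≡∣p∣⇒p⊆q p (∁ q) (sym (trans (∣p∣≡∣p∩q∣+∣p∩∁q∣ p q) (cong (_+ ∣ p ∩ ∁ q ∣) ∣p∩q∣≡0)))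

∣p∩∁q∣≡0⇒p⊆q : ∀ (p q : Subset n) → ∣ p ∩ ∁ q ∣ ≡ 0 → p ⊆ q
∣p∩∁q∣≡0⇒p⊆q p q ∣p∩∁q∣≡0 = ∣p∩q∣≡∣p∣⇒p⊆q p q (sym
  (trans (∣p∣≡∣p∩q∣+∣p∩∁q∣ p q) (trans (cong (∣ p ∩ q ∣ +_) ∣p∩∁q∣≡0) (+-identityʳ _))))

∣p∣≡1+k⇒Nonempty : ∀ {p : Subset n} {k} → ∣ p ∣ ≡ suc k → Nonempty p
∣p∣≡1+k⇒Nonempty {n} {p} ∣p∣≡1+k with nonempty? p
... | yes nonempty = nonempty
... | no  empty    =
  contradiction (trans (sym ∣p∣≡1+k) (trans (cong ∣_∣ (Empty-unique empty)) (∣⊥∣≡0 n))) λ ()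

∩-monoˡ-⊆ : ∀ {p q : Subset n} (r : Subset n) → p ⊆ q → p ∩ r ⊆ q ∩ r
∩-monoˡ-⊆ {p = p} r p⊆q x∈p∩r with x∈p∩q⁻ p r x∈p∩r
... | x∈p , x∈r = x∈p∩q⁺ (p⊆q x∈p , x∈r)

∩∁⊆⇒△⊆ : ∀ {p q r : Subset n} → p ∩ ∁ r ⊆ q → q ∩ ∁ r ⊆ p → p △ q ⊆ r
∩∁⊆⇒△⊆ {p = []} {[]} {[]} _ _ ()
∩∁⊆⇒△⊆ {p = x ∷ p} {y ∷ q} {z ∷ r} p∖r⊆q q∖r⊆p with x | y | z
... | outside | outside | _       = out⊆ (∩∁⊆⇒△⊆ (drop-∷-⊆ p∖r⊆q) (drop-∷-⊆ q∖r⊆p))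
... | inside  | inside  | _       = out⊆ (∩∁⊆⇒△⊆ (drop-∷-⊆ p∖r⊆q) (drop-∷-⊆ q∖r⊆p))
... | inside  | outside | inside  = in⊆in (∩∁⊆⇒△⊆ (drop-∷-⊆ p∖r⊆q) (drop-∷-⊆ q∖r⊆p))
... | outside | inside  | inside  = in⊆in (∩∁⊆⇒△⊆ (drop-∷-⊆ p∖r⊆q) (drop-∷-⊆ q∖r⊆p))
... | inside  | outside | outside = contradiction (p∖r⊆q here) λ ()
... | outside | inside  | outside = contradiction (q∖r⊆p here) λ ()

∁-unique : ∀ {S T : Subset n} → S ∩ T ≡ ⊥ → S ∪ T ≡ ⊤ → T ≡ ∁ S
∁-unique {S = []}          {[]}          _ _ = refl
∁-unique {S = inside ∷ S}  {outside ∷ T} S∩T≡⊥ S∪T≡⊤ =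
  cong (outside ∷_) (∁-unique (∷-injectiveʳ S∩T≡⊥) (∷-injectiveʳ S∪T≡⊤))
∁-unique {S = outside ∷ S} {inside ∷ T}  S∩T≡⊥ S∪T≡⊤ =
  cong (inside ∷_) (∁-unique (∷-injectiveʳ S∩T≡⊥) (∷-injectiveʳ S∪T≡⊤))
∁-unique {S = inside ∷ S}  {inside ∷ T}  ()
∁-unique {S = outside ∷ S} {outside ∷ T} _ ()

[1+n]choose-n≡1+n : ∀ m → suc m choose m ≡ suc m
[1+n]choose-n≡1+n m = begin
  suc m choose m           ≡⟨ nCk≡nC[n∸k] (n≤1+n m) ⟩
  suc m choose (suc m ∸ m) ≡⟨ cong (suc m choose_) (m+n∸n≡m 1 m) ⟩
  suc m choose 1           ≡⟨ nC1≡n (suc m) ⟩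
  suc m                    ∎
  where open ≡-Reasoning

pascal : ∀ m k → m choose suc k + m choose k ≡ suc m choose suc k
pascal m k = trans (+-comm (m choose suc k) _) (nCk+nC[k+1]≡[n+1]C[k+1] m k)

Splits : Subset n → ℕ → ℕ → Subset n → Set
Splits S i j A = ∣ A ∩ S ∣ ≡ i × ∣ A ∩ ∁ S ∣ ≡ j

splits? : ∀ (S : Subset n) i j → Decidable (Splits S i j)
splits? S i j A = (∣ A ∩ S ∣ ≟ i) ×-dec (∣ A ∩ ∁ S ∣ ≟ j)

-- Stated with does rather than ⌊_⌋: does commutes definitionally with Dec.map and _×-dec_,
-- so the integrand computes on outside ∷ C and inside ∷ C.
∑-⊆-splits : ∀ (B S : Subset n) i j →
  ∑ (λ C → ⟦ does (C ⊆? B) ∧ does (splits? S i j C) ⟧) ≡ (∣ B ∩ S ∣ choose i) * (∣ B ∩ ∁ S ∣ choose j)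
∑-⊆-splits [] [] zero    zero    = refl
∑-⊆-splits [] [] zero    (suc j) = sym (cong (1 *_) (k>n⇒nCk≡0 {k = suc j} z<s))
∑-⊆-splits [] [] (suc i) j       = sym (cong (_* (0 choose j)) (k>n⇒nCk≡0 {k = suc i} z<s))
∑-⊆-splits {suc n} (outside ∷ B) (_ ∷ S) i j =
  trans (cong₂ _+_ (∑-⊆-splits B S i j) (∑-zero {n} λ _ → refl)) (+-identityʳ _)
∑-⊆-splits (inside ∷ B) (inside ∷ S) zero j =
  trans (cong₂ _+_ (∑-⊆-splits B S zero j) (∑-zero λ C → cong ⟦_⟧ (Bool.∧-zeroʳ (does (C ⊆? B)))))
        (+-identityʳ _)
∑-⊆-splits (inside ∷ B) (inside ∷ S) (suc i) j =
  trans (cong₂ _+_ (∑-⊆-splits B S (suc i) j) (∑-⊆-splits B S i j))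
        (trans (sym (*-distribʳ-+ t (m choose suc i) (m choose i))) (cong (_* t) (pascal m i)))
  where
  m = ∣ B ∩ S ∣
  t = ∣ B ∩ ∁ S ∣ choose j
∑-⊆-splits (inside ∷ B) (outside ∷ S) i zero =
  trans (cong₂ _+_ (∑-⊆-splits B S i zero) (∑-zero λ C → cong ⟦_⟧ (integrand≡false C)))
        (+-identityʳ _)
  where
  integrand≡false : ∀ C → does (C ⊆? B) ∧ (does (∣ C ∩ S ∣ ≟ i) ∧ false) ≡ false
  integrand≡false C = trans (cong (does (C ⊆? B) ∧_) (Bool.∧-zeroʳ _)) (Bool.∧-zeroʳ _)
∑-⊆-splits (inside ∷ B) (outside ∷ S) i (suc j) =
  trans (cong₂ _+_ (∑-⊆-splits B S i (suc j)) (∑-⊆-splits B S i j))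
        (trans (sym (*-distribˡ-+ u (m choose suc j) (m choose j))) (cong (u *_) (pascal m j)))
  where
  m = ∣ B ∩ ∁ S ∣
  u = ∣ B ∩ S ∣ choose i

restrict : ∀ {P : Subset n → Set} → Family n → Decidable P → Family n
restrict F P? A = F A ∧ does (P? A)

∈-restrict⁺ : ∀ (F : Family n) {P : Subset n → Set} (P? : Decidable P) → A ∈F F → P A → A ∈F restrict F P?
∈-restrict⁺ {A = A} _ P? A∈F pA rewrite A∈F = dec-true (P? A) pA

∈-restrict⁻ : ∀ (F : Family n) {P : Subset n → Set} (P? : Decidable P) → A ∈F restrict F P? → A ∈F F × P A
∈-restrict⁻ {A = A} _ P? A∈F↾P with ∧-true⁻ A∈F↾P
... | A∈F , P?A = A∈F , does⇒ (P? A) P?A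

∈-induced⁺ : ∀ (F : Family n) X → A ∈F F → A ⊆ X → A ∈F induced F X
∈-induced⁺ {A = A} _ X A∈F A⊆X rewrite A∈F = ⌊⌋-true (A ⊆? X) A⊆X

∈-between⁺ : ∀ (F : Family n) S T → A ∈F F → Nonempty (A ∩ S) → Nonempty (A ∩ T) → A ∈F between F S T
∈-between⁺ {A = A} _ S T A∈F meetsS meetsT
  rewrite A∈F | ⌊⌋-true (nonempty? (A ∩ S)) meetsS = ⌊⌋-true (nonempty? (A ∩ T)) meetsT

_∪ᶠ_ : Family n → Family n → Family n
(F ∪ᶠ F′) A = F A ∨ F′ A

infixr 6 _∪ᶠ_

∈-∪ᶠ⁺ˡ : ∀ (F F′ : Family n) → A ∈F F → A ∈F (F ∪ᶠ F′)
∈-∪ᶠ⁺ˡ _ _ A∈F rewrite A∈F = refl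

∈-∪ᶠ⁺ʳ : ∀ (F F′ : Family n) → A ∈F F′ → A ∈F (F ∪ᶠ F′)
∈-∪ᶠ⁺ʳ {A = A} F _ A∈F′ rewrite A∈F′ = Bool.∨-zeroʳ (F A)

card-mono : ∀ (F F′ : Family n) → (∀ A → A ∈F F → A ∈F F′) → card F ≤ card F′
card-mono F F′ F⊆F′ rewrite card≡∑ F | card≡∑ F′ = ∑-mono-≤ (λ A → ⟦⟧-mono (F⊆F′ A))

card-∪ᶠ : ∀ (F F′ : Family n) → card (F ∪ᶠ F′) ≤ card F + card F′
card-∪ᶠ F F′ rewrite card≡∑ (F ∪ᶠ F′) | card≡∑ F | card≡∑ F′ =
  ≤-trans (∑-mono-≤ (λ A → ⟦∨⟧≤⟦⟧+⟦⟧ (F A) (F′ A))) (≤-reflexive (∑-distrib-+ (λ A → ⟦ F A ⟧) (λ A → ⟦ F′ A ⟧)))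

double-counting : ∀ (X Y : Family n) (R : Subset n → Subset n → Bool) k →
  (∀ B → B ∈F X → k ≤ ∑ (λ C → ⟦ R B C ⟧)) →
  (∀ B C → R B C ≡ true → C ∈F Y) →
  (∀ B B′ C → R B C ≡ true → R B′ C ≡ true → B ≡ B′) →
  k * card X ≤ card Y
double-counting X Y R k fan-out lands unique = begin
  k * card X                      ≡⟨ cong (k *_) (card≡∑ X) ⟩
  k * ∑ (λ B → ⟦ X B ⟧)           ≡⟨ *-distribˡ-∑ k (λ B → ⟦ X B ⟧) ⟩
  ∑ (λ B → k * ⟦ X B ⟧)           ≤⟨ ∑-mono-≤ out-degree ⟩
  ∑ (λ B → ∑ (λ C → ⟦ R B C ⟧))   ≡⟨ ∑-comm (λ B C → ⟦ R B C ⟧) ⟩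
  ∑ (λ C → ∑ (λ B → ⟦ R B C ⟧))   ≤⟨ ∑-mono-≤ in-degree ⟩
  ∑ (λ C → ⟦ Y C ⟧)               ≡⟨ card≡∑ Y ⟨
  card Y                          ∎
  where
  open ≤-Reasoning
  out-degree : ∀ B → k * ⟦ X B ⟧ ≤ ∑ (λ C → ⟦ R B C ⟧)
  out-degree B with X B in B∈X
  ... | true  = subst (_≤ ∑ (λ C → ⟦ R B C ⟧)) (sym (*-identityʳ k)) (fan-out B B∈X)
  ... | false = subst (_≤ ∑ (λ C → ⟦ R B C ⟧)) (sym (*-zeroʳ k)) z≤n
  in-degree : ∀ C → ∑ (λ B → ⟦ R B C ⟧) ≤ ⟦ Y C ⟧
  in-degree C with Y C in C∈Y
  ... | true  = ∑-⟦⟧≤1 (λ B → R B C) (λ B B′ → unique B B′ C)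
  ... | false = ≤-reflexive (∑-zero (λ B → ⟦⟧≡0 (λ RBC → contradiction (trans (sym C∈Y) (lands B C RBC)) λ ())))

card-restrict-splits-0 : ∀ (F : Family n) S j → card (restrict F (splits? S 0 j)) ≤ card (induced F (∁ S))
card-restrict-splits-0 F S j = card-mono _ (induced F (∁ S)) λ A A∈F↾ →
  let A∈F , ∣A∩S∣≡0 , _ = ∈-restrict⁻ F (splits? S 0 j) A∈F↾ in ∈-induced⁺ F (∁ S) A∈F (∣p∩q∣≡0⇒p⊆∁q A S ∣A∩S∣≡0)

card-restrict-splits-ʳ0 : ∀ (F : Family n) S i → card (restrict F (splits? S i 0)) ≤ card (induced F S)
card-restrict-splits-ʳ0 F S i = card-mono _ (induced F S) λ A A∈F↾ →
  let A∈F , _ , ∣A∩∁S∣≡0 = ∈-restrict⁻ F (splits? S i 0) A∈F↾ in ∈-induced⁺ F S A∈F (∣p∩∁q∣≡0⇒p⊆q A S ∣A∩∁S∣≡0)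

card-restrict-splits-suc-suc : ∀ (F : Family n) S i j →
  card (restrict F (splits? S (suc i) (suc j))) ≤ card (between F S (∁ S))
card-restrict-splits-suc-suc F S i j = card-mono _ (between F S (∁ S)) λ A A∈F↾ →
  let A∈F , ∣A∩S∣≡1+i , ∣A∩∁S∣≡1+j = ∈-restrict⁻ F (splits? S (suc i) (suc j)) A∈F↾
  in ∈-between⁺ F S (∁ S) A∈F (∣p∣≡1+k⇒Nonempty ∣A∩S∣≡1+i) (∣p∣≡1+k⇒Nonempty ∣A∩∁S∣≡1+j)

splits-of-triple : ∀ (S : Subset n) → ∣ B ∣ ≡ 3 →
  Splits S 0 3 B ⊎ Splits S 1 2 B ⊎ Splits S 2 1 B ⊎ Splits S 3 0 B
splits-of-triple {B = B} S ∣B∣≡3 =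
  by-sizes ∣ B ∩ S ∣ ∣ B ∩ ∁ S ∣ refl refl (trans (sym (∣p∣≡∣p∩q∣+∣p∩∁q∣ B S)) ∣B∣≡3)
  where
  by-sizes : ∀ i j → ∣ B ∩ S ∣ ≡ i → ∣ B ∩ ∁ S ∣ ≡ j → i + j ≡ 3 →
             Splits S 0 3 B ⊎ Splits S 1 2 B ⊎ Splits S 2 1 B ⊎ Splits S 3 0 B
  by-sizes 0 _ ∣B∩S∣≡i ∣B∩∁S∣≡j refl = inj₁ (∣B∩S∣≡i , ∣B∩∁S∣≡j)
  by-sizes 1 _ ∣B∩S∣≡i ∣B∩∁S∣≡j refl = inj₂ (inj₁ (∣B∩S∣≡i , ∣B∩∁S∣≡j))
  by-sizes 2 _ ∣B∩S∣≡i ∣B∩∁S∣≡j refl = inj₂ (inj₂ (inj₁ (∣B∩S∣≡i , ∣B∩∁S∣≡j)))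
  by-sizes 3 _ ∣B∩S∣≡i ∣B∩∁S∣≡j refl = inj₂ (inj₂ (inj₂ (∣B∩S∣≡i , ∣B∩∁S∣≡j)))

card-3graph-by-splitting : ∀ {H : Family n} S → Is3Graph H →
  card H ≤ card (induced H (∁ S)) + (card (restrict H (splits? S 1 2))
             + (card (restrict H (splits? S 2 1)) + card (restrict H (splits? S 3 0))))
card-3graph-by-splitting {H = H} S is3 =
  ≤-trans (card-mono H (H₀ ∪ᶠ H₁₂ ∪ᶠ H₂₁ ∪ᶠ H₃₀) classify)
          (≤-trans (card-∪ᶠ H₀ _) (+-monoʳ-≤ _ (≤-trans (card-∪ᶠ H₁₂ _) (+-monoʳ-≤ _ (card-∪ᶠ H₂₁ H₃₀)))))
  where
  H₀ = induced H (∁ S)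
  H₁₂ = restrict H (splits? S 1 2)
  H₂₁ = restrict H (splits? S 2 1)
  H₃₀ = restrict H (splits? S 3 0)
  classify : ∀ B → B ∈F H → B ∈F (H₀ ∪ᶠ H₁₂ ∪ᶠ H₂₁ ∪ᶠ H₃₀)
  classify B B∈H with splits-of-triple {B = B} S (is3 B B∈H)
  ... | inj₁ (∣B∩S∣≡0 , _) =
    ∈-∪ᶠ⁺ˡ H₀ (H₁₂ ∪ᶠ H₂₁ ∪ᶠ H₃₀) (∈-induced⁺ H (∁ S) B∈H (∣p∩q∣≡0⇒p⊆∁q B S ∣B∩S∣≡0))
  ... | inj₂ (inj₁ s) =
    ∈-∪ᶠ⁺ʳ H₀ (H₁₂ ∪ᶠ H₂₁ ∪ᶠ H₃₀) (∈-∪ᶠ⁺ˡ H₁₂ (H₂₁ ∪ᶠ H₃₀) (∈-restrict⁺ H (splits? S 1 2) B∈H s))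
  ... | inj₂ (inj₂ (inj₁ s)) =
    ∈-∪ᶠ⁺ʳ H₀ (H₁₂ ∪ᶠ H₂₁ ∪ᶠ H₃₀) (∈-∪ᶠ⁺ʳ H₁₂ (H₂₁ ∪ᶠ H₃₀)
      (∈-∪ᶠ⁺ˡ H₂₁ H₃₀ (∈-restrict⁺ H (splits? S 2 1) B∈H s)))
  ... | inj₂ (inj₂ (inj₂ s)) =
    ∈-∪ᶠ⁺ʳ H₀ (H₁₂ ∪ᶠ H₂₁ ∪ᶠ H₃₀) (∈-∪ᶠ⁺ʳ H₁₂ (H₂₁ ∪ᶠ H₃₀)
      (∈-∪ᶠ⁺ʳ H₂₁ H₃₀ (∈-restrict⁺ H (splits? S 3 0) B∈H s)))

triples-sharing-a-pair : ∣ B ∣ ≡ 3 → ∣ B′ ∣ ≡ 3 → B ≢ B′ → C ⊆ B → C ⊆ B′ → ∣ C ∣ ≡ 2 → ∣ B △ B′ ∣ ≡ 2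
triples-sharing-a-pair {B = B} {B′} ∣B∣≡3 ∣B′∣≡3 B≢B′ C⊆B C⊆B′ ∣C∣≡2 = +-cancelʳ-≡ 4 _ _ (begin
  ∣ B △ B′ ∣ + 4                 ≡⟨ cong (λ k → ∣ B △ B′ ∣ + 2 * k) ∣B∩B′∣≡2 ⟨
  ∣ B △ B′ ∣ + 2 * ∣ B ∩ B′ ∣    ≡⟨ ∣p△q∣+2∣p∩q∣≡∣p∣+∣q∣ B B′ ⟩
  ∣ B ∣ + ∣ B′ ∣                 ≡⟨ cong₂ _+_ ∣B∣≡3 ∣B′∣≡3 ⟩
  2 + 4                          ∎)
  where
  open ≡-Reasoning
  ∣B∩B′∣≢3 : ∣ B ∩ B′ ∣ ≢ 3
  ∣B∩B′∣≢3 ∣B∩B′∣≡3 = B≢B′ (trans (sym (fills (p∩q⊆p B B′) ∣B∣≡3)) (fills (p∩q⊆q B B′) ∣B′∣≡3))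
    where
    fills : ∀ {X} → B ∩ B′ ⊆ X → ∣ X ∣ ≡ 3 → B ∩ B′ ≡ X
    fills B∩B′⊆X ∣X∣≡3 = p⊆q∧∣q∣≤∣p∣⇒p≡q B∩B′⊆X (≤-reflexive (trans ∣X∣≡3 (sym ∣B∩B′∣≡3)))
  ∣B∩B′∣≡2 : ∣ B ∩ B′ ∣ ≡ 2
  ∣B∩B′∣≡2 = ≤-antisym
    (s≤s⁻¹ (≤∧≢⇒< (subst (∣ B ∩ B′ ∣ ≤_) ∣B∣≡3 (∣p∩q∣≤∣p∣ B B′)) ∣B∩B′∣≢3))
    (subst (_≤ ∣ B ∩ B′ ∣) ∣C∣≡2 (p⊆q⇒∣p∣≤∣q∣ (λ x∈C → x∈p∩q⁺ (C⊆B x∈C , C⊆B′ x∈C))))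

p⊆q∧∣q∩∁r∣≡∣p∩∁r∣⇒q∩∁r⊆p : ∀ {p q : Subset n} r → p ⊆ q → ∣ q ∩ ∁ r ∣ ≡ ∣ p ∩ ∁ r ∣ → q ∩ ∁ r ⊆ p
p⊆q∧∣q∩∁r∣≡∣p∩∁r∣⇒q∩∁r⊆p {p = p} r p⊆q same-size =
  subst (_⊆ p) (p⊆q∧∣q∣≤∣p∣⇒p≡q (∩-monoˡ-⊆ (∁ r) p⊆q) (≤-reflexive same-size)) (p∩q⊆p p (∁ r))

module _ {G H : Family n} {S : Subset n}
         (is3 : Is3Graph H) (cancellative : Cancellative G H) (complete : CompleteOn G S) where

  cancellative-twins : B ∈F H → B′ ∈F H → C ⊆ B → C ⊆ B′ → ∣ C ∣ ≡ 2 → B △ B′ ⊆ S → B ≡ B′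
  cancellative-twins {B = B} {B′} B∈H B′∈H C⊆B C⊆B′ ∣C∣≡2 △⊆S =
    decidable-stable (≡-dec Bool._≟_ B B′) λ B≢B′ →
      let ∣△∣≡2 = triples-sharing-a-pair (is3 B B∈H) (is3 B′ B′∈H) B≢B′ C⊆B C⊆B′ ∣C∣≡2
          ≢△ : ∀ {X} → X ∈F H → X ≢ B △ B′
          ≢△ X∈H X≡△ = contradiction (trans (sym (is3 _ X∈H)) (trans (cong ∣_∣ X≡△) ∣△∣≡2)) λ ()
      in proj₂ cancellative B B′ (B △ B′) B∈H B′∈H (inj₁ (complete _ △⊆S ∣△∣≡2))
                            B≢B′ (≢△ B∈H) (≢△ B′∈H) ⊆-refl

  [1+a]*card-triples≤card-edges : ∀ a b → a + b ≡ 2 →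
    suc a * card (restrict H (splits? S (suc a) b)) ≤ card (restrict G (splits? S a b))
  [1+a]*card-triples≤card-edges a b a+b≡2 =
    double-counting X (restrict G (splits? S a b)) R (suc a) fan-out lands unique
    where
    X : Family n
    X = restrict H (splits? S (suc a) b)
    R : Subset n → Subset n → Bool
    R B C = X B ∧ does (C ⊆? B ×-dec splits? S a b C)

    R⁻ : ∀ B C → R B C ≡ true → (B ∈F H × Splits S (suc a) b B) × C ⊆ B × Splits S a b C
    R⁻ B C RBC with ∧-true⁻ RBC
    ... | B∈X , C? = ∈-restrict⁻ H (splits? S (suc a) b) B∈X , does⇒ (C ⊆? B ×-dec splits? S a b C) C?

    ∣C∣≡2 : ∀ C → Splits S a b C → ∣ C ∣ ≡ 2
    ∣C∣≡2 C (∣C∩S∣≡a , ∣C∩∁S∣≡b) = trans (∣p∣≡∣p∩q∣+∣p∩∁q∣ C S) (trans (cong₂ _+_ ∣C∩S∣≡a ∣C∩∁S∣≡b) a+b≡2)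

    fan-out : ∀ B → B ∈F X → suc a ≤ ∑ (λ C → ⟦ R B C ⟧)
    fan-out B B∈X with (∣B∩S∣≡1+a , ∣B∩∁S∣≡b) ← proj₂ (∈-restrict⁻ H (splits? S (suc a) b) B∈X)
      rewrite B∈X = ≤-reflexive (sym (begin
      ∑ (λ C → ⟦ does (C ⊆? B) ∧ does (splits? S a b C) ⟧)
        ≡⟨ ∑-⊆-splits B S a b ⟩
      (∣ B ∩ S ∣ choose a) * (∣ B ∩ ∁ S ∣ choose b)
        ≡⟨ cong₂ (λ k l → (k choose a) * (l choose b)) ∣B∩S∣≡1+a ∣B∩∁S∣≡b ⟩
      (suc a choose a) * (b choose b)
        ≡⟨ cong₂ _*_ ([1+n]choose-n≡1+n a) (nCn≡1 b) ⟩
      suc a * 1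
        ≡⟨ *-identityʳ (suc a) ⟩
      suc a
        ∎))
      where open ≡-Reasoning

    lands : ∀ B C → R B C ≡ true → C ∈F restrict G (splits? S a b)
    lands B C RBC with R⁻ B C RBC
    ... | (B∈H , _) , C⊆B , splitsC =
      ∈-restrict⁺ G (splits? S a b) (proj₁ cancellative B C B∈H C⊆B (∣C∣≡2 C splitsC)) splitsC

    -- B and B′ meet ∁ S in as many points as C does, hence exactly where C does;
    -- so they differ only inside S.
    unique : ∀ B B′ C → R B C ≡ true → R B′ C ≡ true → B ≡ B′
    unique B B′ C RBC RB′C with R⁻ B C RBC | R⁻ B′ C RB′C
    ... | (B∈H , _ , ∣B∩∁S∣≡b) , C⊆B , splitsC@(_ , ∣C∩∁S∣≡b) | (B′∈H , _ , ∣B′∩∁S∣≡b) , C⊆B′ , _ =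
      cancellative-twins B∈H B′∈H C⊆B C⊆B′ (∣C∣≡2 C splitsC)
        (∩∁⊆⇒△⊆ (⊆-trans (p⊆q∧∣q∩∁r∣≡∣p∩∁r∣⇒q∩∁r⊆p S C⊆B (trans ∣B∩∁S∣≡b (sym ∣C∩∁S∣≡b))) C⊆B′)
                 (⊆-trans (p⊆q∧∣q∩∁r∣≡∣p∩∁r∣⇒q∩∁r⊆p S C⊆B′ (trans ∣B′∩∁S∣≡b (sym ∣C∩∁S∣≡b))) C⊆B))

lemma4p1 : (n : ℕ) (G H : Family n) (S T : Subset n) →
    IsGraph G → Is3Graph H → Cancellative G H →
    S ∩ T ≡ ⊥ → S ∪ T ≡ ⊤ →
    CompleteOn G S →
    6 * card H ≤ 6 * card (induced H T) + 6 * card (induced G T)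
                 + 3 * card (between G S T) + 2 * card (induced G S)
lemma4p1 n G H S T _ is3 cancellative S∩T≡⊥ S∪T≡⊤ complete rewrite ∁-unique S∩T≡⊥ S∪T≡⊤ = begin
  6 * card H
    ≤⟨ *-monoʳ-≤ 6 (card-3graph-by-splitting S is3) ⟩
  6 * (card (induced H (∁ S)) + (card (H↾ 1 2) + (card (H↾ 2 1) + card (H↾ 3 0))))
    ≡⟨ regroup (card (induced H (∁ S))) (card (H↾ 1 2)) (card (H↾ 2 1)) (card (H↾ 3 0)) ⟩
  6 * card (induced H (∁ S)) + 6 * (1 * card (H↾ 1 2)) + 3 * (2 * card (H↾ 2 1)) + 2 * (3 * card (H↾ 3 0))
    ≤⟨ +-mono-≤ (+-mono-≤ (+-monoʳ-≤ (6 * card (induced H (∁ S)))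
                   (*-monoʳ-≤ 6 (≤-trans (bound 0 2 refl) (card-restrict-splits-0 G S 2))))
                   (*-monoʳ-≤ 3 (≤-trans (bound 1 1 refl) (card-restrict-splits-suc-suc G S 0 0))))
                   (*-monoʳ-≤ 2 (≤-trans (bound 2 0 refl) (card-restrict-splits-ʳ0 G S 2))) ⟩
  6 * card (induced H (∁ S)) + 6 * card (induced G (∁ S)) + 3 * card (between G S (∁ S)) + 2 * card (induced G S)
    ∎
  where
  open ≤-Reasoning
  H↾ : ℕ → ℕ → Family n
  H↾ i j = restrict H (splits? S i j)
  bound : ∀ a b → a + b ≡ 2 → suc a * card (H↾ (suc a) b) ≤ card (restrict G (splits? S a b))
  bound = [1+a]*card-triples≤card-edges is3 cancellative complete
  regroup : ∀ h x y z → 6 * (h + (x + (y + z))) ≡ 6 * h + 6 * (1 * x) + 3 * (2 * y) + 2 * (3 * z)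
  regroup = solve-∀
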